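{- Let $\phi$ be an $\mathrm{XTN}$ formula and $S=\langle T,\beta,\sigma\rangle$ a restricted $\mathrm{XTN}$ structure. If $\sigma_{i+1}$ is standard, then for any two non-standard instants $j,k\in T$ with $\sigma_i\le j<k<\sigma_{i+1}$, we have $S,j\models\phi$ if and only if $S,k\models\phi$ (under the restricted semantics).
   Context: Fix an infinitesimal $\varepsilon>0$ (a non-standard number that is positive and smaller than every positive real). The time domain is $T=\{v+k\varepsilon : v,k\in\mathbb{N}\}$; $v+k\varepsilon$ is standard iff $k=0$, non-standard otherwise. Let $AP$ be a finite set of propositional letters. An $\mathrm{XTN}$ structure is $S=\langle T,\beta,\sigma\rangle$ with $\beta:T\to 2^{AP}$ and $\sigma=(\sigma_i)_i$ a finite or infinite strictly increasing sequence in $T$ with $\sigma_0=0$ and $\beta(t)=\beta(\sigma_i)$ whenever $\sigma_i<t<\sigma_{i+1}$. $\mathrm{XTN}$ formulas: $\phi ::= p \mid \neg\phi \mid \phi_1\wedge\phi_2 \mid \mathrm{Dist}(\phi,1)\mid \mathrm{Dist}(\phi,-1)\mid \mathrm{Dist}(\phi,\varepsilon)\mid \mathrm{Until}(\phi_1,\phi_2)\mid \mathrm{Since}(\phi_1,\phi_2)\mid \mathbf{X}_{st}\phi\mid \mathbf{X}_{ns}\phi\mid \mathrm{NowST}$. Semantics at $i\in T$: $p$ iff $p\in\beta(i)$; Booleans as usual; $\mathrm{Dist}(\phi,d)$ iff $i+d\in T$ and $\phi$ holds at $i+d$; $\mathrm{Until}(\phi,\psi)$ iff for some $d\ge0$ with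 $i+d\in T$, $\psi$ holds at $i+d$ and $\phi$ holds at $i+v$ for all $0\le v<d$; $\mathrm{Since}(\phi,\psi)$ iff for some $d\ge0$ with $i-d\in T$, $\psi$ holds at $i-d$ and $\phi$ holds at $i+v$ for all $-d<v\le0$; $\mathbf{X}_{st}\phi$ (resp. $\mathbf{X}_{ns}\phi$) iff for some $j$, $\sigma_j\le i<\sigma_{j+1}$, $\sigma_{j+1}$ is standard (resp. non-standard), and $\phi$ holds at $\sigma_{j+1}$; $\mathrm{NowST}$ iff $i$ is standard. Write $\mathrm{true}$ for a tautology and $\mathbf{F}\phi=\mathrm{Until}(\mathrm{true},\phi)$. Restrictions: a restricted structure satisfies (C1) the set of standard elements of $\sigma$ is either all of $\mathbb{N}$ or an initial segment $\{0,1,\dots,n\}$; (C2) if $\sigma_{i+1}$ is non-standard then $\sigma_{i+1}-\sigma_i=\varepsilon$. The restricted semantics additionally stipulates that $\mathrm{Dist}(\phi,1)$ and $\mathrm{Dist}(\phi,-1)$ are meaningful only at standard instants (they are false at non-standard instants), and every subformula $\psi$ of the formula is read as $\psi\wedge\mathbf{F}(\mathbf{X}_{st}\mathrm{true}\vee\mathbf{X}_{ns}\mathrm{true})$. -}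

module Defs where

open import Data.Nat using (ℕ; zero; suc; _+_; _≤_; _<_)
open import Data.Fin using (Fin)
open import Data.Fin.Subset using (Subset; _∈_)
open import Data.Product using (Σ; _×_; _,_; proj₁; proj₂; ∃)
open import Data.Sum using (_⊎_)
open import Data.Unit using (⊤)
open import Relation.Nullary using (¬_)
open import Relation.Binary.PropositionalEquality using (_≡_)

-- Time domain T = { v + k·ε : v,k ∈ ℕ }, the element v + k·ε is represented by (v , k).
T : Set
T = ℕ × ℕ

Standard : T → Set
Standard t = proj₂ t ≡ 0

NonStandard : T → Set
NonStandard t = ¬ Standard t

-- Since ε is a positive infinitesimal, the order on T is lexicographic.
data _<T_ : T → T → Set where
  <-std : ∀ {v k v' k'} → v < v' → (v , k) <T (v' , k')
  <-ns  : ∀ {v k k'} → k < k' → (v , k) <T (v , k')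

_≤T_ : T → T → Set
s ≤T t = s <T t ⊎ s ≡ t

-- Length of the sequence σ: infinite, or finite with n ≥ 1 elements σ_0 … σ_{n-1}.
data Len : Set where
  inf : Len
  fin : (n : ℕ) → 1 ≤ n → Len

Valid : Len → ℕ → Set
Valid inf m = ⊤
Valid (fin n _) m = m < n

record Structure (nAP : ℕ) : Set where
  field
    β     : T → Subset nAP
    len   : Len
    σ     : ℕ → T          -- only the values at valid indices matter
    σ-0   : σ 0 ≡ (0 , 0)
    σ-inc : ∀ m → Valid len (suc m) → σ m <T σ (suc m)
    β-const : ∀ m t → Valid len (suc m) → σ m <T t → t <T σ (suc m) → β t ≡ β (σ m)

open Structure public

StdInσ : ∀ {nAP} → Structure nAP → ℕ → Set
StdInσ S v = Σ ℕ λ m → Valid (len S) m × σ S m ≡ (v , 0)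

C1 : ∀ {nAP} → Structure nAP → Set
C1 S = (∀ v → StdInσ S v)
     ⊎ (Σ ℕ λ n → ∀ v → (StdInσ S v → v ≤ n) × (v ≤ n → StdInσ S v))

C2 : ∀ {nAP} → Structure nAP → Set
C2 S = ∀ m → Valid (len S) (suc m) → NonStandard (σ S (suc m)) →
       σ S (suc m) ≡ (proj₁ (σ S m) , suc (proj₂ (σ S m)))

Restricted : ∀ {nAP} → Structure nAP → Set
Restricted S = C1 S × C2 S

data Formula (nAP : ℕ) : Set where
  atom    : Fin nAP → Formula nAP
  ¬'_     : Formula nAP → Formula nAP
  _∧'_    : Formula nAP → Formula nAP → Formula nAP
  Dist+1  : Formula nAP → Formula nAP
  Dist-1  : Formula nAP → Formula nAP
  Distε   : Formula nAP → Formula nAP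
  Until   : Formula nAP → Formula nAP → Formula nAP
  Since   : Formula nAP → Formula nAP → Formula nAP
  Xst     : Formula nAP → Formula nAP
  Xns     : Formula nAP → Formula nAP
  NowST   : Formula nAP

true' : ∀ {nAP} → Formula nAP
true' = ¬' (NowST ∧' (¬' NowST))

_∨'_ : ∀ {nAP} → Formula nAP → Formula nAP → Formula nAP
a ∨' b = ¬' ((¬' a) ∧' (¬' b))

F : ∀ {nAP} → Formula nAP → Formula nAP
F φ = Until true' φ

_,_⊨_ : ∀ {nAP} → Structure nAP → T → Formula nAP → Set
S , i ⊨ atom p = p ∈ β S i
S , i ⊨ (¬' φ) = ¬ (S , i ⊨ φ)
S , i ⊨ (φ ∧' ψ) = (S , i ⊨ φ) × (S , i ⊨ ψ)
S , (v , k) ⊨ Dist+1 φ = S , (suc v , k) ⊨ φ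
S , (v , k) ⊨ Dist-1 φ = Σ ℕ λ v' → v ≡ suc v' × (S , (v' , k) ⊨ φ)
S , (v , k) ⊨ Distε φ = S , (v , suc k) ⊨ φ
S , i ⊨ Until φ ψ = Σ T λ t → i ≤T t × (S , t ⊨ ψ) × (∀ s → i ≤T s → s <T t → S , s ⊨ φ)
S , i ⊨ Since φ ψ = Σ T λ t → t ≤T i × (S , t ⊨ ψ) × (∀ s → t <T s → s ≤T i → S , s ⊨ φ)
S , i ⊨ Xst φ = Σ ℕ λ m → Valid (len S) (suc m) × σ S m ≤T i × i <T σ S (suc m)
                  × Standard (σ S (suc m)) × (S , σ S (suc m) ⊨ φ)
S , i ⊨ Xns φ = Σ ℕ λ m → Valid (len S) (suc m) × σ S m ≤T i × i <T σ S (suc m)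
                  × NonStandard (σ S (suc m)) × (S , σ S (suc m) ⊨ φ)
S , i ⊨ NowST = Standard i

Guard : ∀ {nAP} → Structure nAP → T → Set
Guard S i = S , i ⊨ F (Xst true' ∨' Xns true')

_,_⊨ʳ_ : ∀ {nAP} → Structure nAP → T → Formula nAP → Set
S , i ⊨ʳ φ = Guard S i × clause φ
  where
  clause : _ → Set
  clause (atom p) = p ∈ β S i
  clause (¬' φ) = ¬ (S , i ⊨ʳ φ)
  clause (φ ∧' ψ) = (S , i ⊨ʳ φ) × (S , i ⊨ʳ ψ)
  clause (Dist+1 φ) = Standard i × (S , (suc (proj₁ i) , proj₂ i) ⊨ʳ φ)
  clause (Dist-1 φ) = Standard i × (Σ ℕ λ v' → proj₁ i ≡ suc v' × (S , (v' , proj₂ i) ⊨ʳ φ))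
  clause (Distε φ) = S , (proj₁ i , suc (proj₂ i)) ⊨ʳ φ
  clause (Until φ ψ) = Σ T λ t → i ≤T t × (S , t ⊨ʳ ψ) × (∀ s → i ≤T s → s <T t → S , s ⊨ʳ φ)
  clause (Since φ ψ) = Σ T λ t → t ≤T i × (S , t ⊨ʳ ψ) × (∀ s → t <T s → s ≤T i → S , s ⊨ʳ φ)
  clause (Xst φ) = Σ ℕ λ m → Valid (len S) (suc m) × σ S m ≤T i × i <T σ S (suc m)
                     × Standard (σ S (suc m)) × (S , σ S (suc m) ⊨ʳ φ)
  clause (Xns φ) = Σ ℕ λ m → Valid (len S) (suc m) × σ S m ≤T i × i <T σ S (suc m)
                     × NonStandard (σ S (suc m)) × (S , σ S (suc m) ⊨ʳ φ)
  clause NowST = Standard i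

-- Every point of the block B of non-standard instants in [σ_i, σ_{i+1}) satisfies the
-- guard, carries the valuation of σ_i and has σ_{i+1} as its next point of σ.  By (C1),
-- no standard point lies strictly between σ_i and the standard σ_{i+1}, so B is convex
-- and closed under ε-steps.  Induction on φ then transfers truth between any two points
-- of B: Dist(·, ±1) and NowST are false throughout B, a Dist(·, ε) goes to another pair
-- of points of B, and an Until (Since) witness either lies in B, where it can be moved
-- to the evaluation point itself, or lies after (before) all of B.
module Submission where

open import Defs
open import Data.Nat using (ℕ; suc; _≤_; _<_; _≤′_; ≤′-reflexive; ≤′-step; _≤?_)
open import Data.Nat.Properties
  using (<-trans; <-irrefl; <-cmp; <⇒≤; ≤-refl; ≤-trans; n≤1+n; ≤-<-trans; ≤⇒≤′; ≰⇒>;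
         _≟_)
open import Data.Product using (_×_; _,_; proj₁; proj₂)
open import Data.Sum using (inj₁; inj₂)
open import Data.Unit using (tt)
open import Data.Fin.Subset using (_∈_)
open import Function.Base using (_∘_)
open import Function.Bundles using (_⇔_; mk⇔)
open import Relation.Nullary using (¬_; yes; no; contradiction)
open import Relation.Nullary.Decidable using (¬?; _×-dec_)
open import Relation.Unary as U using (Pred)
open import Relation.Binary using (Transitive; Trichotomous; Decidable; tri<; tri≈; tri>)
open import Relation.Binary.Consequences using (tri⇒dec<)
import Relation.Binary.Construct.StrictToNonStrict as StrictToNonStrict
open import Relation.Binary.PropositionalEquality using (_≡_; _≢_; refl; sym; trans; subst)

<T-trans : Transitive _<T_
<T-trans (<-std p) (<-std q) = <-std (<-trans p q)
<T-trans (<-std p) (<-ns q)  = <-std p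
<T-trans (<-ns p)  (<-std q) = <-std q
<T-trans (<-ns p)  (<-ns q)  = <-ns (<-trans p q)

<T-irrefl : ∀ {t} → ¬ t <T t
<T-irrefl (<-std p) = <-irrefl refl p
<T-irrefl (<-ns p)  = <-irrefl refl p

<T⇒≢ : ∀ {s t} → s <T t → s ≢ t
<T⇒≢ s<t refl = <T-irrefl s<t

<T-asym : ∀ {s t} → s <T t → ¬ t <T s
<T-asym s<t t<s = <T-irrefl (<T-trans s<t t<s)

<T-cmp : Trichotomous _≡_ _<T_
<T-cmp (v , k) (v' , k') with <-cmp v v'
... | tri< p _ _ = tri< (<-std p) (<T⇒≢ (<-std p)) (<T-asym (<-std p))
... | tri> _ _ p = tri> (<T-asym (<-std p)) (<T⇒≢ (<-std p) ∘ sym) (<-std p)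
... | tri≈ _ refl _ with <-cmp k k'
...   | tri< p _ _ = tri< (<-ns p) (<T⇒≢ (<-ns p)) (<T-asym (<-ns p))
...   | tri≈ _ refl _ = tri≈ <T-irrefl refl <T-irrefl
...   | tri> _ _ p = tri> (<T-asym (<-ns p)) (<T⇒≢ (<-ns p) ∘ sym) (<-ns p)

_<T?_ : Decidable _<T_
_<T?_ = tri⇒dec< <T-cmp

_≤T?_ : Decidable _≤T_
_≤T?_ = StrictToNonStrict.decidable′ _≡_ _<T_ <T-cmp

≤T-<T-trans : ∀ {s t u} → s ≤T t → t <T u → s <T u
≤T-<T-trans (inj₁ s<t) t<u = <T-trans s<t t<u
≤T-<T-trans (inj₂ refl) t<u = t<u

<T-≤T-trans : ∀ {s t u} → s <T t → t ≤T u → s <T u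
<T-≤T-trans s<t (inj₁ t<u) = <T-trans s<t t<u
<T-≤T-trans s<t (inj₂ refl) = s<t

≤T-trans : ∀ {s t u} → s ≤T t → t ≤T u → s ≤T u
≤T-trans (inj₁ s<t) t≤u = inj₁ (<T-≤T-trans s<t t≤u)
≤T-trans (inj₂ refl) t≤u = t≤u

≤T⇒≯T : ∀ {s t} → s ≤T t → ¬ t <T s
≤T⇒≯T s≤t t<s = <T-irrefl (≤T-<T-trans s≤t t<s)

<T⇒proj₁≤ : ∀ {s t} → s <T t → proj₁ s ≤ proj₁ t
<T⇒proj₁≤ (<-std p) = <⇒≤ p
<T⇒proj₁≤ (<-ns _)  = ≤-refl

infix 25 _+ε
_+ε : T → T
t +ε = proj₁ t , suc (proj₂ t)

<T-+ε : ∀ t → t <T t +ε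
<T-+ε t = <-ns ≤-refl

+ε-<T-standard : ∀ {t u} → Standard u → t <T u → t +ε <T u
+ε-<T-standard refl (<-std p) = <-std p

Standard⇒≡ : ∀ {t} → Standard t → t ≡ (proj₁ t , 0)
Standard⇒≡ refl = refl

Convex : Pred T _ → Set
Convex P = ∀ {a b x} → P a → P b → a ≤T x → x ≤T b → P x

module _ {P : Pred T _} (convex : Convex P) where

  convex-below : ∀ {a b x} → P a → P b → x ≤T a → ¬ P x → x <T b
  convex-below {b = b} {x = x} Pa Pb x≤a ¬Px with <T-cmp x b
  ... | tri< x<b _ _ = x<b
  ... | tri≈ _ refl _ = contradiction Pb ¬Px
  ... | tri> _ _ b<x = contradiction (convex Pb Pa (inj₁ b<x) x≤a) ¬Px

  convex-above : ∀ {a b x} → P a → P b → a ≤T x → ¬ P x → b <T x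
  convex-above {b = b} {x = x} Pa Pb a≤x ¬Px with <T-cmp b x
  ... | tri< b<x _ _ = b<x
  ... | tri≈ _ refl _ = contradiction Pb ¬Px
  ... | tri> _ _ x<b = contradiction (convex Pa Pb a≤x (inj₁ x<b)) ¬Px

Valid-≤ : ∀ L {m n} → m ≤ n → Valid L n → Valid L m
Valid-≤ inf       _   _ = tt
Valid-≤ (fin _ _) m≤n n<l = ≤-<-trans m≤n n<l

true'-holds : ∀ {nAP} (S : Structure nAP) t → S , t ⊨ true'
true'-holds S t (st , ¬st) = ¬st st

module _ {nAP} (S : Structure nAP) where

  σ-mono′ : ∀ {m n} → m ≤′ n → Valid (len S) n → σ S m ≤T σ S n
  σ-mono′ (≤′-reflexive refl) _ = inj₂ refl
  σ-mono′ (≤′-step m≤′n) v =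
    inj₁ (≤T-<T-trans (σ-mono′ m≤′n (Valid-≤ (len S) (n≤1+n _) v)) (σ-inc S _ v))

  σ-mono : ∀ {m n} → m ≤ n → Valid (len S) n → σ S m ≤T σ S n
  σ-mono m≤n = σ-mono′ (≤⇒≤′ m≤n)

  InInterval : ℕ → T → Set
  InInterval m t = Valid (len S) (suc m) × σ S m ≤T t × t <T σ S (suc m)

  InInterval-disjoint : ∀ {m n t} → m < n → InInterval m t → ¬ InInterval n t
  InInterval-disjoint m<n (_ , _ , t<σm+1) (vn , σn≤t , _) =
    ≤T⇒≯T (≤T-trans (σ-mono m<n (Valid-≤ (len S) (n≤1+n _) vn)) σn≤t) t<σm+1

  InInterval-unique : ∀ {m n t} → InInterval m t → InInterval n t → m ≡ n
  InInterval-unique {m} {n} t∈m t∈n with <-cmp m n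
  ... | tri< m<n _ _ = contradiction t∈n (InInterval-disjoint m<n t∈m)
  ... | tri≈ _ m≡n _ = m≡n
  ... | tri> _ _ n<m = contradiction t∈m (InInterval-disjoint n<m t∈n)

  β-interval : ∀ {m t} → InInterval m t → β S t ≡ β S (σ S m)
  β-interval (_ , inj₂ refl , _) = refl
  β-interval {m} {t} (vm , inj₁ σm<t , t<σm+1) = β-const S m t vm σm<t t<σm+1

  Guard-interval : ∀ {m t} → InInterval m t → Guard S t
  Guard-interval {m} {t} (vm , σm≤t , t<σm+1) =
    t , inj₂ refl , next-point , λ s _ _ → true'-holds S s
    where
    next-point : S , t ⊨ (Xst true' ∨' Xns true')
    next-point (¬next-st , ¬next-ns) with proj₂ (σ S (suc m)) ≟ 0
    ... | yes st  = ¬next-st (m , vm , σm≤t , t<σm+1 , st , true'-holds S (σ S (suc m)))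
    ... | no ¬st = ¬next-ns (m , vm , σm≤t , t<σm+1 , ¬st , true'-holds S (σ S (suc m)))

  StdInσ-downward : C1 S → ∀ {v w} → v ≤ w → StdInσ S w → StdInσ S v
  StdInσ-downward (inj₁ all) {v} _ _ = all v
  StdInσ-downward (inj₂ (n , seg)) {v} {w} v≤w w∈σ =
    proj₂ (seg v) (≤-trans v≤w (proj₁ (seg w) w∈σ))

  C1⇒no-standard-inside : C1 S → ∀ {i u} → Valid (len S) (suc i) → Standard (σ S (suc i)) →
                          Standard u → σ S i <T u → ¬ u <T σ S (suc i)
  C1⇒no-standard-inside c1 {i} {w , _} vi σi+1-std refl σi<u u<σi+1
    with StdInσ-downward c1 (<T⇒proj₁≤ u<σi+1) (suc i , vi , Standard⇒≡ σi+1-std)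
  ... | m , vm , σm≡u with m ≤? i
  ...   | yes m≤i =
    ≤T⇒≯T (subst (_≤T σ S i) σm≡u (σ-mono m≤i (Valid-≤ (len S) (n≤1+n i) vi))) σi<u
  ...   | no m≰i = ≤T⇒≯T (subst (σ S (suc i) ≤T_) σm≡u (σ-mono (≰⇒> m≰i) vm)) u<σi+1

module NonStandardBlock {nAP} (S : Structure nAP) (c1 : C1 S) (i : ℕ)
  (vi : Valid (len S) (suc i)) (σi+1-std : Standard (σ S (suc i))) where

  Block : Pred T _
  Block t = NonStandard t × σ S i ≤T t × t <T σ S (suc i)

  Block? : U.Decidable Block
  Block? t = ¬? (proj₂ t ≟ 0) ×-dec (σ S i ≤T? t) ×-dec (t <T? σ S (suc i))

  Block⇒InInterval : ∀ {t} → Block t → InInterval S i t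
  Block⇒InInterval (_ , σi≤t , t<σi+1) = vi , σi≤t , t<σi+1

  Block-Guard : ∀ {t} → Block t → Guard S t
  Block-Guard Bt = Guard-interval S (Block⇒InInterval Bt)

  Block-β : ∀ {s k} → Block s → Block k → β S s ≡ β S k
  Block-β Bs Bk =
    trans (β-interval S (Block⇒InInterval Bs)) (sym (β-interval S (Block⇒InInterval Bk)))

  Block-convex : Convex Block
  Block-convex {a} {b} {x} (a-ns , σi≤a , _) (_ , _ , b<σi+1) a≤x x≤b =
    x-ns a≤x , ≤T-trans σi≤a a≤x , x<σi+1
    where
    x<σi+1 : x <T σ S (suc i)
    x<σi+1 = ≤T-<T-trans x≤b b<σi+1
    x-ns : a ≤T x → NonStandard x
    x-ns (inj₂ a≡x) = subst NonStandard a≡x a-ns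
    x-ns (inj₁ a<x) x-std =
      C1⇒no-standard-inside S c1 vi σi+1-std x-std (≤T-<T-trans σi≤a a<x) x<σi+1

  Block-+ε : ∀ {t} → Block t → Block (t +ε)
  Block-+ε {t} (_ , σi≤t , t<σi+1) =
    (λ ()) , ≤T-trans σi≤t (inj₁ (<T-+ε t)) , +ε-<T-standard σi+1-std t<σi+1

  BlockInvariant : Formula nAP → Set
  BlockInvariant φ = ∀ {s k} → Block s → Block k → S , s ⊨ʳ φ → S , k ⊨ʳ φ

  Until-invariant : ∀ {φ ψ} → BlockInvariant φ → BlockInvariant ψ → BlockInvariant (Until φ ψ)
  Until-invariant {φ} inv-φ inv-ψ {s} {k} Bs Bk (_ , t , s≤t , ψ-t , φ-until-t) with Block? t
  ... | yes Bt =
    Block-Guard Bk , k , inj₂ refl , inv-ψ Bt Bk ψ-t , λ u k≤u u<k → contradiction u<k (≤T⇒≯T k≤u)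
  ... | no ¬Bt =
    Block-Guard Bk , t , inj₁ (convex-above Block-convex Bs Bk s≤t ¬Bt) , ψ-t , φ-from-k
    where
    φ-from-k : ∀ u → k ≤T u → u <T t → S , u ⊨ʳ φ
    φ-from-k u k≤u u<t with Block? u
    ... | yes Bu = inv-φ Bs Bu (φ-until-t s (inj₂ refl) (convex-above Block-convex Bs Bs s≤t ¬Bt))
    ... | no ¬Bu = φ-until-t u (inj₁ (convex-above Block-convex Bk Bs k≤u ¬Bu)) u<t

  Since-invariant : ∀ {φ ψ} → BlockInvariant φ → BlockInvariant ψ → BlockInvariant (Since φ ψ)
  Since-invariant {φ} inv-φ inv-ψ {s} {k} Bs Bk (_ , t , t≤s , ψ-t , φ-since-t) with Block? t
  ... | yes Bt =
    Block-Guard Bk , k , inj₂ refl , inv-ψ Bt Bk ψ-t , λ u k<u u≤k → contradiction k<u (≤T⇒≯T u≤k)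
  ... | no ¬Bt =
    Block-Guard Bk , t , inj₁ (convex-below Block-convex Bs Bk t≤s ¬Bt) , ψ-t , φ-to-k
    where
    φ-to-k : ∀ u → t <T u → u ≤T k → S , u ⊨ʳ φ
    φ-to-k u t<u u≤k with Block? u
    ... | yes Bu = inv-φ Bs Bu (φ-since-t s (convex-below Block-convex Bs Bs t≤s ¬Bt) (inj₂ refl))
    ... | no ¬Bu = φ-since-t u t<u (inj₁ (convex-below Block-convex Bk Bs u≤k ¬Bu))

  Block-invariant : ∀ φ → BlockInvariant φ
  Block-invariant (atom p) Bs Bk (_ , p∈βs) =
    Block-Guard Bk , subst (p ∈_) (Block-β Bs Bk) p∈βs
  Block-invariant (¬' φ) Bs Bk (_ , ¬φ-s) =
    Block-Guard Bk , λ φ-k → ¬φ-s (Block-invariant φ Bk Bs φ-k)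
  Block-invariant (φ ∧' ψ) Bs Bk (_ , φ-s , ψ-s) =
    Block-Guard Bk , Block-invariant φ Bs Bk φ-s , Block-invariant ψ Bs Bk ψ-s
  Block-invariant (Dist+1 φ) (s-ns , _) _ (_ , s-std , _) = contradiction s-std s-ns
  Block-invariant (Dist-1 φ) (s-ns , _) _ (_ , s-std , _) = contradiction s-std s-ns
  Block-invariant (Distε φ) Bs Bk (_ , φ-s+ε) =
    Block-Guard Bk , Block-invariant φ (Block-+ε Bs) (Block-+ε Bk) φ-s+ε
  Block-invariant (Until φ ψ) = Until-invariant (Block-invariant φ) (Block-invariant ψ)
  Block-invariant (Since φ ψ) = Since-invariant (Block-invariant φ) (Block-invariant ψ)
  Block-invariant (Xst φ) Bs Bk@(_ , σi≤k , k<σi+1) (_ , m , vm , σm≤s , s<σm+1 , next-std , φ-next)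
    with InInterval-unique S (vm , σm≤s , s<σm+1) (Block⇒InInterval Bs)
  ... | refl = Block-Guard Bk , i , vi , σi≤k , k<σi+1 , next-std , φ-next
  Block-invariant (Xns φ) Bs Bk (_ , m , vm , σm≤s , s<σm+1 , next-ns , _)
    with InInterval-unique S (vm , σm≤s , s<σm+1) (Block⇒InInterval Bs)
  ... | refl = contradiction σi+1-std next-ns
  Block-invariant NowST (s-ns , _) _ (_ , s-std) = contradiction s-std s-ns

lemma2 : ∀ {nAP} (S : Structure nAP) → Restricted S → (φ : Formula nAP) →
         ∀ i → Valid (len S) (suc i) → Standard (σ S (suc i)) →
         ∀ j k → NonStandard j → NonStandard k →
         σ S i ≤T j → j <T k → k <T σ S (suc i) →
         (S , j ⊨ʳ φ) ⇔ (S , k ⊨ʳ φ)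
lemma2 S (c1 , _) φ i vi σi+1-std j k j-ns k-ns σi≤j j<k k<σi+1 =
  mk⇔ (Block-invariant φ Bj Bk) (Block-invariant φ Bk Bj)
  where
  open NonStandardBlock S c1 i vi σi+1-std
  Bj : Block j
  Bj = j-ns , σi≤j , <T-trans j<k k<σi+1
  Bk : Block k
  Bk = k-ns , inj₁ (≤T-<T-trans σi≤j j<k) , k<σi+1
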